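{- Let $G=(V,E)$ be an undirected graph with $n = |V|$ vertices and let $k \geq 1$ be an integer. Let $A_0 = \emptyset$ and, for $i \geq 0$, $A_{i+1} = A_i \cup \{v_{i+1}\}$ where $v_{i+1} \in \arg\max_{v \in V \setminus A_i} dom(A_i \cup \{v\})$ (ties broken arbitrarily), producing a single sequence $A_0, A_1, \ldots, A_{n-1}$. For $1 \leq p \leq n-1$ define $\theta_p = \frac{ext(A_p)}{p}$ and $\sigma_p = \frac{ext(A_p)}{n-p}$. Then $\theta_1 \geq \theta_2 \geq \cdots \geq \theta_{n-1}$ and $\sigma_1 \leq \sigma_2 \leq \cdots \leq \sigma_{n-1}$.
   Context: For $A \subseteq V$, $dom(A) = \left|\bigcup_{v \in A} \mathcal{N}_k[v]\right|$, where $\mathcal{N}_k[v] = \{u \in V : dist(v,u) \leq k\}$ is the closed $k$-neighborhood of $v$ (including $v$), and $ext(A) = dom(A) - |A|$ is the number of vertices dominated by $A$ that are not in $A$. -}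

module Defs where

open import Data.Bool using (Bool; true; false; _∨_; _∧_)
open import Data.Nat using (ℕ; zero; suc; _∸_)
open import Data.Fin using (Fin)
open import Data.Fin.Properties using (_≟_)
open import Data.Fin.Subset using (Subset; ⋃; ∣_∣; _∪_; ⁅_⁆; ⊥; _∉_)
open import Data.Fin.Subset.Properties using (_∈?_)
open import Data.List using (List; map; filter; allFin)
open import Data.Bool.ListAction using (any)
open import Data.Product using (_×_)
open import Data.Vec using (tabulate)
open import Data.Integer using (+_)
open import Data.Rational using (ℚ; _/_; 0ℚ)
open import Relation.Nullary.Decidable using (⌊_⌋)
open import Relation.Binary.PropositionalEquality using (_≡_)

record Graph (n : ℕ) : Set where
  field
    adj     : Fin n → Fin n → Bool
    symm    : ∀ u v → adj u v ≡ adj v u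
    irrefl  : ∀ v → adj v v ≡ false
open Graph public

-- within G k v u = true  iff  dist(v,u) ≤ k, i.e. there is a walk of
-- length at most k from v to u.
within : ∀ {n} → Graph n → ℕ → Fin n → Fin n → Bool
within G zero    v u = ⌊ v ≟ u ⌋
within G (suc k) v u =
  within G k v u ∨ any (λ w → within G k v w ∧ adj G w u) (allFin _)

Nk : ∀ {n} → Graph n → ℕ → Fin n → Subset n
Nk G k v = tabulate (λ u → within G k v u)

dom : ∀ {n} → Graph n → ℕ → Subset n → ℕ
dom {n} G k A = ∣ ⋃ (map (Nk G k) (filter (_∈? A) (allFin n))) ∣

-- ext(A) = dom(A) - |A|   (dom(A) ≥ |A| always, so ∸ is exact)
ext : ∀ {n} → Graph n → ℕ → Subset n → ℕ
ext G k A = dom G k A ∸ ∣ A ∣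

-- The sets A_i built from a vertex sequence: seq i = v_{i+1}.
-- A 0 = ∅,  A (i+1) = A i ∪ {v_{i+1}}.
Aset : ∀ {n} → (ℕ → Fin n) → ℕ → Subset n
Aset seq zero    = ⊥
Aset seq (suc i) = Aset seq i ∪ ⁅ seq i ⁆

IsGreedy : ∀ {n} → Graph n → ℕ → (ℕ → Fin n) → Set
IsGreedy {n} G k seq =
  ∀ i → suc i Data.Nat.≤ n ∸ 1 →
    (seq i ∉ Aset seq i) × (∀ u → u ∉ Aset seq i →
       dom G k (Aset seq i ∪ ⁅ u ⁆) Data.Nat.≤ dom G k (Aset seq (suc i)))

-- a / d as a rational; only used with d ≠ 0 (the d = 0 branch is a dummy).
frac : ℕ → ℕ → ℚ
frac a zero    = 0ℚ
frac a (suc d) = (+ a) / suc d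

theta : ∀ {n} → Graph n → ℕ → (ℕ → Fin n) → ℕ → ℚ
theta G k seq p = frac (ext G k (Aset seq p)) p

sigma : ∀ {n} → Graph n → ℕ → (ℕ → Fin n) → ℕ → ℚ
sigma {n} G k seq p = frac (ext G k (Aset seq p)) (n ∸ p)

-- dom is a coverage function, hence submodular, so greedy choices make the gains
-- Δ_i = dom(A_{i+1}) - dom(A_i) non-increasing, and therefore dom(A_p) ≥ p Δ_p.
-- Since ext(A_{p+1}) + 1 = ext(A_p) + Δ_p, the inequality θ_{p+1} ≤ θ_p reduces to
-- p Δ_p ≤ dom(A_p).  For σ: if Δ_p ≥ 1 then ext does not decrease while n - p does;
-- if Δ_p = 0 then greediness forces A_p to dominate all of V, and σ_p = σ_{p+1} = 1.
module Submission where

open import Defs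
open import Data.Nat using (ℕ; suc; _≤_; _∸_)
open import Data.Fin using (Fin)
open import Data.Product using (_×_)
import Data.Rational as ℚ

open import Function using (_∘_)
open import Data.Nat using (zero; _+_; _*_; z≤n; s≤s)
open import Data.Nat.Properties hiding (_≟_)
open import Data.Bool using (true)
open import Data.Empty using (⊥-elim)
open import Data.Fin.Properties using (_≟_)
open import Data.Fin.Subset
  using (Subset; inside; outside; ⋃; ∣_∣; _∪_; _∩_; ⁅_⁆; _∈_; _∉_; _⊆_)
open import Data.Fin.Subset.Properties
  using ( _∈?_; ∉⊥; ∣⊥∣≡0; ∣⊤∣≡n; ⊆⊤; ⊆-antisym; ∪-identityʳ; x∈⁅x⁆; x∈⁅y⁆⇒x≡y
        ; p⊆p∪q; x∈p∪q⁺; x∈p∪q⁻; x∈p∩q⁺; p⊆q⇒∣p∣≤∣q∣; ∣p∣≤∣p∪q∣; p⊂q⇒∣p∣<∣q∣ )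
open import Data.List using (List; []; _∷_; map; filter; allFin)
open import Data.List.Relation.Unary.Any as Any using (Any)
open import Data.List.Relation.Unary.Any.Properties using (map⁺; map⁻)
open import Data.List.Membership.Propositional using (find; lose)
open import Data.List.Membership.Propositional.Properties using (∈-filter⁺; ∈-filter⁻; ∈-allFin)
open import Data.Product using (_,_; proj₁; proj₂; ∃-syntax)
open import Data.Sum using (inj₁; inj₂)
open import Data.Vec using (_∷_; []; here; there)
open import Data.Vec.Properties using (lookup∘tabulate; lookup⇒[]=)
open import Relation.Nullary using (yes; no)
open import Relation.Binary.PropositionalEquality
import Data.Integer as ℤ
import Data.Integer.Properties as ℤ
import Data.Rational.Properties as ℚ
import Data.Rational.Unnormalised as ℚᵘ
import Data.Rational.Unnormalised.Properties as ℚᵘ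

∣p∪⁅x⁆∣≡1+∣p∣ : ∀ {n} (p : Subset n) x → x ∉ p → ∣ p ∪ ⁅ x ⁆ ∣ ≡ suc ∣ p ∣
∣p∪⁅x⁆∣≡1+∣p∣ (inside  ∷ p) Fin.zero    x∉p = ⊥-elim (x∉p here)
∣p∪⁅x⁆∣≡1+∣p∣ (outside ∷ p) Fin.zero    x∉p = cong (suc ∘ ∣_∣) (∪-identityʳ p)
∣p∪⁅x⁆∣≡1+∣p∣ (inside  ∷ p) (Fin.suc x) x∉p = cong suc (∣p∪⁅x⁆∣≡1+∣p∣ p x (x∉p ∘ there))
∣p∪⁅x⁆∣≡1+∣p∣ (outside ∷ p) (Fin.suc x) x∉p = ∣p∪⁅x⁆∣≡1+∣p∣ p x (x∉p ∘ there)

∣p∪q∣+∣p∩q∣≡∣p∣+∣q∣ : ∀ {n} (p q : Subset n) → ∣ p ∪ q ∣ + ∣ p ∩ q ∣ ≡ ∣ p ∣ + ∣ q ∣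
∣p∪q∣+∣p∩q∣≡∣p∣+∣q∣ []            []            = refl
∣p∪q∣+∣p∩q∣≡∣p∣+∣q∣ (inside  ∷ p) (inside  ∷ q) = cong suc (begin
  ∣ p ∪ q ∣ + suc ∣ p ∩ q ∣    ≡⟨ +-suc ∣ p ∪ q ∣ ∣ p ∩ q ∣ ⟩
  suc (∣ p ∪ q ∣ + ∣ p ∩ q ∣)  ≡⟨ cong suc (∣p∪q∣+∣p∩q∣≡∣p∣+∣q∣ p q) ⟩
  suc (∣ p ∣ + ∣ q ∣)          ≡⟨ +-suc ∣ p ∣ ∣ q ∣ ⟨
  ∣ p ∣ + suc ∣ q ∣            ∎)
  where open ≡-Reasoning
∣p∪q∣+∣p∩q∣≡∣p∣+∣q∣ (inside  ∷ p) (outside ∷ q) = cong suc (∣p∪q∣+∣p∩q∣≡∣p∣+∣q∣ p q)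
∣p∪q∣+∣p∩q∣≡∣p∣+∣q∣ (outside ∷ p) (inside  ∷ q) =
  trans (cong suc (∣p∪q∣+∣p∩q∣≡∣p∣+∣q∣ p q)) (sym (+-suc ∣ p ∣ ∣ q ∣))
∣p∪q∣+∣p∩q∣≡∣p∣+∣q∣ (outside ∷ p) (outside ∷ q) = ∣p∪q∣+∣p∩q∣≡∣p∣+∣q∣ p q

∣p∪r∣+∣q∣≤∣p∣+∣q∪r∣ : ∀ {n} {p q : Subset n} (r : Subset n) → q ⊆ p →
  ∣ p ∪ r ∣ + ∣ q ∣ ≤ ∣ p ∣ + ∣ q ∪ r ∣
∣p∪r∣+∣q∣≤∣p∣+∣q∪r∣ {p = p} {q} r q⊆p = begin
  ∣ p ∪ r ∣ + ∣ q ∣                       ≤⟨ +-mono-≤ (p⊆q⇒∣p∣≤∣q∣ p∪r⊆) (p⊆q⇒∣p∣≤∣q∣ q⊆) ⟩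
  ∣ p ∪ (q ∪ r) ∣ + ∣ p ∩ (q ∪ r) ∣       ≡⟨ ∣p∪q∣+∣p∩q∣≡∣p∣+∣q∣ p (q ∪ r) ⟩
  ∣ p ∣ + ∣ q ∪ r ∣                       ∎
  where
  open ≤-Reasoning
  p∪r⊆ : p ∪ r ⊆ p ∪ (q ∪ r)
  p∪r⊆ x∈ with x∈p∪q⁻ p r x∈
  ... | inj₁ x∈p = x∈p∪q⁺ (inj₁ x∈p)
  ... | inj₂ x∈r = x∈p∪q⁺ {p = p} (inj₂ (x∈p∪q⁺ {p = q} (inj₂ x∈r)))
  q⊆ : q ⊆ p ∩ (q ∪ r)
  q⊆ x∈q = x∈p∩q⁺ (q⊆p x∈q , p⊆p∪q r x∈q)

∀∈⇒∣p∣≡n : ∀ {n} (p : Subset n) → (∀ x → x ∈ p) → ∣ p ∣ ≡ n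
∀∈⇒∣p∣≡n {n} p ∀∈ = trans (cong ∣_∣ (⊆-antisym ⊆⊤ (λ {x} _ → ∀∈ x))) (∣⊤∣≡n n)

∈⋃⁻ : ∀ {n} (ps : List (Subset n)) {x} → x ∈ ⋃ ps → Any (x ∈_) ps
∈⋃⁻ []       x∈ = ⊥-elim (∉⊥ x∈)
∈⋃⁻ (p ∷ ps) x∈ with x∈p∪q⁻ p (⋃ ps) x∈
... | inj₁ x∈p  = Any.here x∈p
... | inj₂ x∈ps = Any.there (∈⋃⁻ ps x∈ps)

∈⋃⁺ : ∀ {n} {ps : List (Subset n)} {x} → Any (x ∈_) ps → x ∈ ⋃ ps
∈⋃⁺              (Any.here x∈p)   = x∈p∪q⁺ (inj₁ x∈p)
∈⋃⁺ {ps = p ∷ _} (Any.there x∈ps) = x∈p∪q⁺ {p = p} (inj₂ (∈⋃⁺ x∈ps))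

Δ : (ℕ → ℕ) → ℕ → ℕ
Δ d i = d (suc i) ∸ d i

∸-concave : ∀ {a b c} → a ≤ b → b ≤ c → c + a ≤ b + b → c ∸ b ≤ b ∸ a
∸-concave {a} {b} {c} a≤b b≤c c+a≤b+b = +-cancelʳ-≤ (b + a) (c ∸ b) (b ∸ a) (begin
  (c ∸ b) + (b + a)   ≡⟨ +-assoc (c ∸ b) b a ⟨
  (c ∸ b) + b + a     ≡⟨ cong (_+ a) (m∸n+n≡m b≤c) ⟩
  c + a               ≤⟨ c+a≤b+b ⟩
  b + b               ≡⟨ cong (b +_) (m∸n+n≡m a≤b) ⟨
  b + ((b ∸ a) + a)   ≡⟨ +-assoc b (b ∸ a) a ⟨
  b + (b ∸ a) + a     ≡⟨ cong (_+ a) (+-comm b (b ∸ a)) ⟩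
  (b ∸ a) + b + a     ≡⟨ +-assoc (b ∸ a) b a ⟩
  (b ∸ a) + (b + a)   ∎)
  where open ≤-Reasoning

antitone-stepwise : ∀ (f : ℕ → ℕ) {p} → (∀ {j} → suc j ≤ p → f (suc j) ≤ f j) →
  ∀ {i} → i ≤ p → f p ≤ f i
antitone-stepwise f {zero}  step z≤n = ≤-refl
antitone-stepwise f {suc p} step i≤1+p with m≤n⇒m<n∨m≡n i≤1+p
... | inj₂ refl       = ≤-refl
... | inj₁ (s≤s i≤p) =
  ≤-trans (step ≤-refl) (antitone-stepwise f (step ∘ m≤n⇒m≤1+n) i≤p)

antitone-Δ⇒*Δ≤ : ∀ (d : ℕ → ℕ) {p} → (∀ i → d i ≤ d (suc i)) →
  (∀ {j} → suc j ≤ p → Δ d (suc j) ≤ Δ d j) → p * Δ d p ≤ d p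
antitone-Δ⇒*Δ≤ d {p} mono step = go p ≤-refl
  where
  go : ∀ i → i ≤ p → i * Δ d p ≤ d i
  go zero    _     = z≤n
  go (suc i) 1+i≤p = begin
    Δ d p + i * Δ d p  ≤⟨ +-mono-≤ (antitone-stepwise (Δ d) step i≤p) (go i i≤p) ⟩
    Δ d i + d i        ≡⟨ m∸n+n≡m (mono i) ⟩
    d (suc i)          ∎
    where
    open ≤-Reasoning
    i≤p : i ≤ p
    i≤p = ≤-trans (n≤1+n i) 1+i≤p

within-refl : ∀ {n} (G : Graph n) k v → within G k v v ≡ true
within-refl G zero v with v ≟ v
... | yes _   = refl
... | no v≢v = ⊥-elim (v≢v refl)
within-refl G (suc k) v rewrite within-refl G k v = refl

module Coverage {n} (G : Graph n) (k : ℕ) where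

  N : Fin n → Subset n
  N = Nk G k

  -- Unfolds to the term in the definition of dom, so dom G k A is ∣ covered A ∣ by refl.
  covered : Subset n → Subset n
  covered A = ⋃ (map N (filter (_∈? A) (allFin n)))

  v∈N[v] : ∀ v → v ∈ N v
  v∈N[v] v = lookup⇒[]= v (N v) (trans (lookup∘tabulate (within G k v) v) (within-refl G k v))

  ∈covered⁻ : ∀ A {x} → x ∈ covered A → ∃[ w ] w ∈ A × x ∈ N w
  ∈covered⁻ A x∈ with find (map⁻ (∈⋃⁻ (map N (filter (_∈? A) (allFin n))) x∈))
  ... | w , w∈ , x∈N[w] = w , proj₂ (∈-filter⁻ (_∈? A) {xs = allFin n} w∈) , x∈N[w]

  ∈covered⁺ : ∀ A {w x} → w ∈ A → x ∈ N w → x ∈ covered A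
  ∈covered⁺ A {w} w∈A x∈N[w] = ∈⋃⁺ (map⁺ (lose (∈-filter⁺ (_∈? A) (∈-allFin w) w∈A) x∈N[w]))

  A⊆covered : ∀ A → A ⊆ covered A
  A⊆covered A {x} x∈A = ∈covered⁺ A x∈A (v∈N[v] x)

  covered-∪⁅⁆ : ∀ A v → covered (A ∪ ⁅ v ⁆) ≡ covered A ∪ N v
  covered-∪⁅⁆ A v = ⊆-antisym ⊆-part ⊇-part
    where
    ⊆-part : covered (A ∪ ⁅ v ⁆) ⊆ covered A ∪ N v
    ⊆-part x∈ with ∈covered⁻ (A ∪ ⁅ v ⁆) x∈
    ... | w , w∈ , x∈N[w] with x∈p∪q⁻ A ⁅ v ⁆ w∈
    ...   | inj₁ w∈A = x∈p∪q⁺ (inj₁ (∈covered⁺ A w∈A x∈N[w]))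
    ...   | inj₂ w∈v rewrite x∈⁅y⁆⇒x≡y v w∈v = x∈p∪q⁺ {p = covered A} (inj₂ x∈N[w])
    ⊇-part : covered A ∪ N v ⊆ covered (A ∪ ⁅ v ⁆)
    ⊇-part x∈ with x∈p∪q⁻ (covered A) (N v) x∈
    ... | inj₁ x∈cA with ∈covered⁻ A x∈cA
    ...   | w , w∈A , x∈N[w] = ∈covered⁺ (A ∪ ⁅ v ⁆) (p⊆p∪q ⁅ v ⁆ w∈A) x∈N[w]
    ⊇-part x∈ | inj₂ x∈N[v] = ∈covered⁺ (A ∪ ⁅ v ⁆) (x∈p∪q⁺ {p = A} (inj₂ (x∈⁅x⁆ v))) x∈N[v]

module GreedySequence {n} (G : Graph n) (k : ℕ) (seq : ℕ → Fin n) (greedy : IsGreedy G k seq)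
  where
  open Coverage G k

  A : ℕ → Subset n
  A = Aset seq

  d : ℕ → ℕ
  d i = dom G k (A i)

  d-step : ∀ i → d (suc i) ≡ ∣ covered (A i) ∪ N (seq i) ∣
  d-step i = cong ∣_∣ (covered-∪⁅⁆ (A i) (seq i))

  d-mono : ∀ i → d i ≤ d (suc i)
  d-mono i = subst (d i ≤_) (sym (d-step i)) (∣p∣≤∣p∪q∣ (covered (A i)) (N (seq i)))

  greedy-choice : ∀ {i} → suc i ≤ n ∸ 1 → ∀ u → u ∉ A i → ∣ covered (A i) ∪ N u ∣ ≤ d (suc i)
  greedy-choice {i} 1+i≤ u u∉A =
    subst (_≤ d (suc i)) (cong ∣_∣ (covered-∪⁅⁆ (A i) u)) (proj₂ (greedy i 1+i≤) u u∉A)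

  ∣A∣≡ : ∀ i → i ≤ n ∸ 1 → ∣ A i ∣ ≡ i
  ∣A∣≡ zero    _    = ∣⊥∣≡0 n
  ∣A∣≡ (suc i) 1+i≤ = trans (∣p∪⁅x⁆∣≡1+∣p∣ (A i) (seq i) (proj₁ (greedy i 1+i≤)))
                            (cong suc (∣A∣≡ i (≤-trans (n≤1+n i) 1+i≤)))

  d≡i+ext : ∀ i → i ≤ n ∸ 1 → d i ≡ i + ext G k (A i)
  d≡i+ext i i≤ = begin
    d i                        ≡⟨ m+[n∸m]≡n (p⊆q⇒∣p∣≤∣q∣ (A⊆covered (A i))) ⟨
    ∣ A i ∣ + ext G k (A i)    ≡⟨ cong (_+ ext G k (A i)) (∣A∣≡ i i≤) ⟩
    i + ext G k (A i)          ∎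
    where open ≡-Reasoning

  d-concave : ∀ j → suc (suc j) ≤ n ∸ 1 → d (suc (suc j)) + d j ≤ d (suc j) + d (suc j)
  d-concave j 2+j≤ = begin
    d (suc (suc j)) + d j                ≡⟨ cong (_+ d j) (d-step (suc j)) ⟩
    ∣ covered (A (suc j)) ∪ N u ∣ + d j  ≡⟨ cong (λ Y → ∣ Y ∪ N u ∣ + d j) (covered-∪⁅⁆ (A j) v) ⟩
    ∣ (X ∪ N v) ∪ N u ∣ + ∣ X ∣          ≤⟨ ∣p∪r∣+∣q∣≤∣p∣+∣q∪r∣ {q = X} (N u) (p⊆p∪q (N v)) ⟩
    ∣ X ∪ N v ∣ + ∣ X ∪ N u ∣            ≡⟨ cong (_+ ∣ X ∪ N u ∣) (d-step j) ⟨
    d (suc j) + ∣ X ∪ N u ∣              ≤⟨ +-monoʳ-≤ (d (suc j)) (greedy-choice 1+j≤ u u∉A[j]) ⟩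
    d (suc j) + d (suc j)                ∎
    where
    open ≤-Reasoning
    X = covered (A j)
    v = seq j
    u = seq (suc j)
    1+j≤ : suc j ≤ n ∸ 1
    1+j≤ = ≤-trans (n≤1+n (suc j)) 2+j≤
    u∉A[j] : u ∉ A j
    u∉A[j] = proj₁ (greedy (suc j) 2+j≤) ∘ p⊆p∪q ⁅ v ⁆

  p*Δd≤d : ∀ p → suc p ≤ n ∸ 1 → p * Δ d p ≤ d p
  p*Δd≤d p 1+p≤ = antitone-Δ⇒*Δ≤ d d-mono Δd-antitone
    where
    Δd-antitone : ∀ {j} → suc j ≤ p → Δ d (suc j) ≤ Δ d j
    Δd-antitone {j} 1+j≤p =
      ∸-concave (d-mono j) (d-mono (suc j)) (d-concave j (≤-trans (s≤s 1+j≤p) 1+p≤))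

  Δd≡0⇒covered≡V : ∀ i → suc i ≤ n ∸ 1 → Δ d i ≡ 0 → ∀ x → x ∈ covered (A i)
  Δd≡0⇒covered≡V i 1+i≤ Δ≡0 x with x ∈? covered (A i)
  ... | yes x∈ = x∈
  ... | no  x∉ = ⊥-elim (<-irrefl refl (begin-strict
    d i                       <⟨ p⊂q⇒∣p∣<∣q∣ (p⊆p∪q (N x) , x , x∈p∪q⁺ (inj₂ (v∈N[v] x)) , x∉) ⟩
    ∣ covered (A i) ∪ N x ∣   ≤⟨ greedy-choice 1+i≤ x (x∉ ∘ A⊆covered (A i)) ⟩
    d (suc i)                 ≡⟨ m∸n+n≡m (d-mono i) ⟨
    Δ d i + d i               ≡⟨ cong (_+ d i) Δ≡0 ⟩
    d i                       ∎))
    where open ≤-Reasoning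

  Δd≡0⇒ext≡n∸i : ∀ i → suc i ≤ n ∸ 1 → Δ d i ≡ 0 → ext G k (A i) ≡ n ∸ i
  Δd≡0⇒ext≡n∸i i 1+i≤ Δ≡0 =
    cong₂ _∸_ (∀∈⇒∣p∣≡n (covered (A i)) (Δd≡0⇒covered≡V i 1+i≤ Δ≡0))
              (∣A∣≡ i (≤-trans (n≤1+n i) 1+i≤))

  1+ext≡ext+Δd : ∀ p → suc p ≤ n ∸ 1 → suc (ext G k (A (suc p))) ≡ ext G k (A p) + Δ d p
  1+ext≡ext+Δd p 1+p≤ = +-cancelˡ-≡ p _ _ (begin
    p + suc e′            ≡⟨ +-suc p e′ ⟩
    suc p + e′            ≡⟨ d≡i+ext (suc p) 1+p≤ ⟨
    d (suc p)             ≡⟨ m∸n+n≡m (d-mono p) ⟨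
    Δ d p + d p           ≡⟨ cong (Δ d p +_) (d≡i+ext p (≤-trans (n≤1+n p) 1+p≤)) ⟩
    Δ d p + (p + e)       ≡⟨ +-comm (Δ d p) (p + e) ⟩
    p + e + Δ d p         ≡⟨ +-assoc p e (Δ d p) ⟩
    p + (e + Δ d p)       ∎)
    where
    open ≡-Reasoning
    e = ext G k (A p)
    e′ = ext G k (A (suc p))

e′*p≤e*[1+p] : ∀ {e e′ g} p → suc e′ ≡ e + g → p * g ≤ p + e → e′ * p ≤ e * suc p
e′*p≤e*[1+p] {e} {e′} {g} p 1+e′≡e+g p*g≤p+e = +-cancelˡ-≤ p (e′ * p) (e * suc p) (begin
  suc e′ * p         ≡⟨ cong (_* p) 1+e′≡e+g ⟩
  (e + g) * p        ≡⟨ *-distribʳ-+ p e g ⟩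
  e * p + g * p      ≤⟨ +-monoʳ-≤ (e * p) (subst (_≤ p + e) (*-comm p g) p*g≤p+e) ⟩
  e * p + (p + e)    ≡⟨ +-comm (e * p) (p + e) ⟩
  p + e + e * p      ≡⟨ +-assoc p e (e * p) ⟩
  p + (e + e * p)    ≡⟨ cong (p +_) (*-suc e p) ⟨
  p + e * suc p      ∎)
  where open ≤-Reasoning

e*m≤e′*[1+m] : ∀ {e e′ g} m → suc e′ ≡ e + g → (g ≡ 0 → e ≡ suc m) → e * m ≤ e′ * suc m
e*m≤e′*[1+m] {e} {e′} {zero} m 1+e′≡e+0 g≡0⇒e≡1+m with g≡0⇒e≡1+m refl
... | refl = ≤-reflexive (begin
  suc m * m     ≡⟨ *-comm (suc m) m ⟩
  m * suc m     ≡⟨ cong (_* suc m) (suc-injective (trans 1+e′≡e+0 (+-identityʳ (suc m)))) ⟨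
  e′ * suc m    ∎)
  where open ≡-Reasoning
e*m≤e′*[1+m] {e} {e′} {suc g} m 1+e′≡e+1+g _ = *-mono-≤ e≤e′ (n≤1+n m)
  where
  e≤e′ : e ≤ e′
  e≤e′ = subst (e ≤_) (sym (suc-injective (trans 1+e′≡e+1+g (+-suc e g)))) (m≤m+n e g)

fromℚᵘ-mono-≤ : ∀ {p q} → p ℚᵘ.≤ q → ℚ.fromℚᵘ p ℚ.≤ ℚ.fromℚᵘ q
fromℚᵘ-mono-≤ {p} {q} p≤q = ℚ.toℚᵘ-cancel-≤
  (ℚᵘ.≤-respˡ-≃ (ℚᵘ.≃-sym (ℚ.toℚᵘ-fromℚᵘ p)) (ℚᵘ.≤-respʳ-≃ (ℚᵘ.≃-sym (ℚ.toℚᵘ-fromℚᵘ q)) p≤q))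

frac-≤ : ∀ {a b c d} → 1 ≤ b → 1 ≤ d → a * d ≤ c * b → frac a b ℚ.≤ frac c d
frac-≤ {a} {suc b} {c} {suc d} (s≤s _) (s≤s _) a*d≤c*b =
  fromℚᵘ-mono-≤ {ℚᵘ.mkℚᵘ (ℤ.+ a) b} {ℚᵘ.mkℚᵘ (ℤ.+ c) d}
    (ℚᵘ.*≤* (subst₂ ℤ._≤_ (ℤ.pos-* a (suc d)) (ℤ.pos-* c (suc b)) (ℤ.+≤+ a*d≤c*b)))

proposition1 : (n : ℕ) (G : Graph n) (k : ℕ) → 1 ≤ k →
    (seq : ℕ → Fin n) → IsGreedy G k seq →
    ∀ p → 1 ≤ p → suc p ≤ n ∸ 1 →
      (theta G k seq (suc p) ℚ.≤ theta G k seq p)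
      × (sigma G k seq p ℚ.≤ sigma G k seq (suc p))
proposition1 n G k _ seq greedy p 1≤p 1+p≤ = θ-antitone , σ-monotone
  where
  open GreedySequence G k seq greedy
  e  = ext G k (A p)
  e′ = ext G k (A (suc p))
  m  = n ∸ suc p

  1+e′≡e+Δ : suc e′ ≡ e + Δ d p
  1+e′≡e+Δ = 1+ext≡ext+Δd p 1+p≤

  θ-antitone : theta G k seq (suc p) ℚ.≤ theta G k seq p
  θ-antitone = frac-≤ {e′} {suc p} {e} {p} (s≤s z≤n) 1≤p (e′*p≤e*[1+p] p 1+e′≡e+Δ
    (subst (p * Δ d p ≤_) (d≡i+ext p (≤-trans (n≤1+n p) 1+p≤)) (p*Δd≤d p 1+p≤)))

  -- The left-hand side of +-∸-assoc, (1 + n) ∸ suc p, reduces to n ∸ p.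
  n∸p≡1+m : n ∸ p ≡ suc m
  n∸p≡1+m = +-∸-assoc 1 (≤-trans 1+p≤ (m∸n≤m n 1))

  σ-monotone : sigma G k seq p ℚ.≤ sigma G k seq (suc p)
  σ-monotone = frac-≤ {e} {n ∸ p} {e′} {m} (subst (1 ≤_) (sym n∸p≡1+m) (s≤s z≤n))
    (subst (1 ≤_) (∸-+-assoc n 1 p) (m<n⇒0<n∸m 1+p≤))
    (subst (λ x → e * m ≤ e′ * x) (sym n∸p≡1+m) (e*m≤e′*[1+m] m 1+e′≡e+Δ
      (λ Δ≡0 → trans (Δd≡0⇒ext≡n∸i p 1+p≤ Δ≡0) n∸p≡1+m)))
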